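{- Let $P$ be a polyomino with $n$ cells whose perimeter equals the minimum perimeter $p(n)=2\lceil 2\sqrt{n}\rceil$ among polyominoes with $n$ cells, and suppose $h_1>0$ (some cell of $P$ has degree $1$). Then $P$ can also be obtained by deleting cells from a rectangular polyomino (an $a\times b$ rectangle of cells) with perimeter $p(n)$ consisting of at least $n$ cells.
   Context: A polyomino is a finite set of unit squares (cells) of the integer grid, connected via shared edges; its perimeter is the number of unit edges belonging to exactly one cell. The degree of a cell is the number of cells of the polyomino sharing an edge with it. The boundary cycle $H$ is the closed walk, once around the boundary of the polyomino, through the cells touching the boundary, consecutive cells sharing an edge (repetitions allowed); $h_1$ is the number of entries of $H$ that are cells of degree $1$. -}

module Defs where

open import Data.Nat as ℕ using (ℕ; zero; suc; _≤ᵇ_)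
open import Data.Integer as ℤ using (ℤ; +_)
open import Data.Product using (_×_; _,_)
open import Data.Product.Properties using (≡-dec)
open import Data.List using (List; []; _∷_; length; filter; map)
open import Data.Nat.ListAction using (sum)
open import Data.List.Relation.Unary.Unique.Propositional using (Unique)
open import Data.Bool using (if_then_else_)
open import Relation.Binary.PropositionalEquality using (_≡_)
open import Relation.Binary.Definitions using (DecidableEquality)
open import Relation.Nullary.Decidable using (¬?)

-- Cells of the integer grid: the unit square with lower-left corner (x , y).
Cell : Set
Cell = ℤ × ℤ

_≟ᶜ_ : DecidableEquality Cell
_≟ᶜ_ = ≡-dec ℤ._≟_ ℤ._≟_

open import Data.List.Membership.DecPropositional _≟ᶜ_ public using (_∈_; _∈?_; _∉_)

nbrs : Cell → List Cell
nbrs (x , y) = (x ℤ.+ ℤ.+ 1 , y) ∷ (x ℤ.- ℤ.+ 1 , y) ∷ (x , y ℤ.+ ℤ.+ 1) ∷ (x , y ℤ.- ℤ.+ 1) ∷ []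

data Walk (S : List Cell) : Cell → Cell → Set where
  stop : ∀ {c} → c ∈ S → Walk S c c
  step : ∀ {c c' d} → c ∈ S → c' ∈ nbrs c → Walk S c' d → Walk S c d

record Polyomino : Set where
  field
    cells     : List Cell
    unique    : Unique cells
    connected : ∀ {c d} → c ∈ cells → d ∈ cells → Walk cells c d
open Polyomino public

size : Polyomino → ℕ
size P = length (cells P)

degree : Polyomino → Cell → ℕ
degree P c = length (filter (_∈? cells P) (nbrs c))

-- perimeter: number of unit edges belonging to exactly one cell of P,
-- i.e. the number of (cell of P, side) pairs whose cell across that side is not in P.
perimeter : Polyomino → ℕ
perimeter P = sum (map (λ c → length (filter (λ d → ¬? (d ∈? cells P)) (nbrs c))) (cells P))

ceilSqrt : ℕ → ℕ
ceilSqrt m = go m 0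
  where
  go : ℕ → ℕ → ℕ
  go zero    k = k
  go (suc f) k = if m ≤ᵇ k ℕ.* k then k else go f (suc k)

-- p(n) = 2 ⌈2√n⌉ = 2 ⌈√(4n)⌉
minPerimeter : ℕ → ℕ
minPerimeter n = 2 ℕ.* ceilSqrt (4 ℕ.* n)

InRect : ℤ → ℤ → ℕ → ℕ → Cell → Set
InRect x₀ y₀ a b (x , y) =
  (x₀ ℤ.≤ x × x ℤ.< x₀ ℤ.+ + a) × (y₀ ℤ.≤ y × y ℤ.< y₀ ℤ.+ + b)

{-# OPTIONS --safe #-}
module Submission where

-- Let K × M be the bounding box of P. Connectivity makes the columns meeting P an interval of K
-- integers, and the highest and the lowest cell of each column both have a boundary edge on
-- their outer side; likewise for the M rows. Hence 2(K + M) ≤ perimeter P = p(n), while the box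
-- contains all n cells. Widening the box to width p(n)/2 − M keeps P inside, keeps the area at
-- least n and makes the perimeter exactly p(n).

open import Defs hiding (_∈_; _∉_)
open import Data.Nat using (ℕ; suc; _+_; _*_; _∸_; _≤_; _≥_; _<_; s≤s; s≤s⁻¹; z≤n)
import Data.Nat.Properties as ℕₚ
open import Data.Nat.Tactic.RingSolver using (solve-∀)
open import Data.Nat.ListAction using (sum)
open import Data.Integer using (ℤ)
open import Data.Integer as ℤ using (+≤+; +<+; ∣_∣)
import Data.Integer.Properties as ℤₚ
open import Data.Product using (_×_; ∃-syntax; ∃₂; _,_; proj₁; proj₂)
open import Data.Sum using (inj₁; inj₂)
open import Data.List using (List; []; _∷_; _++_; [_]; map; filter; length; applyUpTo; cartesianProduct)
open import Data.List.Properties using (length-++; length-map; length-applyUpTo; length-++-sucʳ; map-cong)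
open import Data.List.Membership.Propositional using (_∈_; _∉_)
open import Data.List.Membership.Propositional.Properties
  using (∈-∃++; ∈-++⁻; ∈-++⁺ˡ; ∈-++⁺ʳ; ∈-map⁺; ∈-map⁻; ∈-filter⁺; ∈-filter⁻;
         ∈-applyUpTo⁺; ∈-applyUpTo⁻; ∈-cartesianProduct⁺)
open import Data.List.Relation.Binary.Subset.Propositional using (_⊆_)
open import Data.List.Relation.Unary.Any using (here; there)
open import Data.List.Relation.Unary.All using (All)
import Data.List.Relation.Unary.All as All
open import Data.List.Relation.Unary.AllPairs using (_∷_)
open import Data.List.Relation.Unary.Unique.Propositional using (Unique)
open import Data.List.Relation.Unary.Unique.Propositional.Properties using (applyUpTo⁺₁)
open import Data.List.Extrema ℤₚ.≤-totalOrder
  using (argmin; argmax; argmin-all; argmax-all;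
         f[argmin]≤f[xs]; f[xs]≤f[argmax]; f[argmin]≤f[⊤]; f[⊥]≤f[argmax])
open import Algebra.Properties.CommutativeSemigroup ℕₚ.+-commutativeSemigroup using (interchange)
open import Function using (_∘_; id)
open import Relation.Nullary using (yes; no; contradiction)
open import Relation.Nullary.Decidable using (¬?)
open import Relation.Unary using (Decidable)
open import Relation.Binary.PropositionalEquality
  using (_≡_; refl; sym; trans; cong; cong₂; subst; module ≡-Reasoning)

private
  variable
    A B I : Set

length-mono-⊆ : {xs ys : List A} → Unique xs → xs ⊆ ys → length xs ≤ length ys
length-mono-⊆ {xs = []} _ _ = z≤n
length-mono-⊆ {xs = x ∷ xs} (x∉xs ∷ xs!) x∷xs⊆ys with ∈-∃++ (x∷xs⊆ys (here refl))
... | as , bs , refl = begin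
  suc (length xs)          ≤⟨ s≤s (length-mono-⊆ xs! xs⊆as++bs) ⟩
  suc (length (as ++ bs))  ≡⟨ length-++-sucʳ as x bs ⟨
  length (as ++ x ∷ bs)    ∎
  where
  open ℕₚ.≤-Reasoning
  xs⊆as++bs : xs ⊆ as ++ bs
  xs⊆as++bs z∈xs with ∈-++⁻ as (x∷xs⊆ys (there z∈xs))
  ... | inj₁ z∈as         = ∈-++⁺ˡ z∈as
  ... | inj₂ (here refl)  = contradiction refl (All.lookup x∉xs z∈xs)
  ... | inj₂ (there z∈bs) = ∈-++⁺ʳ as z∈bs

length-cartesianProduct : (xs : List A) (ys : List B) →
  length (cartesianProduct xs ys) ≡ length xs * length ys
length-cartesianProduct []       ys = refl
length-cartesianProduct (x ∷ xs) ys = begin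
  length (map (x ,_) ys ++ cartesianProduct xs ys)
    ≡⟨ length-++ (map (x ,_) ys) ⟩
  length (map (x ,_) ys) + length (cartesianProduct xs ys)
    ≡⟨ cong₂ _+_ (length-map (x ,_) ys) (length-cartesianProduct xs ys) ⟩
  length ys + length xs * length ys
    ∎
  where open ≡-Reasoning

sum-map-zero : (xs : List A) → sum (map (λ _ → 0) xs) ≡ 0
sum-map-zero []       = refl
sum-map-zero (x ∷ xs) = sum-map-zero xs

sum-map-+ : (f g : A → ℕ) (xs : List A) →
  sum (map (λ x → f x + g x) xs) ≡ sum (map f xs) + sum (map g xs)
sum-map-+ f g []       = refl
sum-map-+ f g (x ∷ xs) = begin
  f x + g x + sum (map (λ x → f x + g x) xs)     ≡⟨ cong ((f x + g x) +_) (sum-map-+ f g xs) ⟩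
  f x + g x + (sum (map f xs) + sum (map g xs))  ≡⟨ interchange (f x) (g x) _ _ ⟩
  f x + sum (map f xs) + (g x + sum (map g xs))  ∎
  where open ≡-Reasoning

module _ {P : B → Set} (P? : Decidable P) where

  length-filter-∷ : (y : B) (ys : List B) →
    length (filter P? (y ∷ ys)) ≡ length (filter P? [ y ]) + length (filter P? ys)
  length-filter-∷ y ys with P? y
  ... | yes _ = refl
  ... | no _  = refl

  length-filter-map : (f : A → B) (xs : List A) →
    length (filter P? (map f xs)) ≡ sum (map (λ x → length (filter P? [ f x ])) xs)
  length-filter-map f []       = refl
  length-filter-map f (x ∷ xs) =
    trans (length-filter-∷ (f x) (map f xs)) (cong (length (filter P? [ f x ]) +_) (length-filter-map f xs))

  -- Both sides count the pairs (i , x) with P (f i x).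
  sum-length-filter-transpose : (f : I → A → B) (is : List I) (xs : List A) →
    sum (map (λ x → length (filter P? (map (λ i → f i x) is))) xs) ≡
    sum (map (λ i → length (filter P? (map (f i) xs))) is)
  sum-length-filter-transpose f []       xs = sum-map-zero xs
  sum-length-filter-transpose f (i ∷ is) xs = begin
    sum (map (λ x → length (filter P? (f i x ∷ map (λ j → f j x) is))) xs)
      ≡⟨ cong sum (map-cong (λ x → length-filter-∷ (f i x) _) xs) ⟩
    sum (map (λ x → length (filter P? [ f i x ]) + length (filter P? (map (λ j → f j x) is))) xs)
      ≡⟨ sum-map-+ _ _ xs ⟩
    sum (map (λ x → length (filter P? [ f i x ])) xs)
      + sum (map (λ x → length (filter P? (map (λ j → f j x) is))) xs)
      ≡⟨ cong₂ _+_ (sym (length-filter-map (f i) xs)) (sum-length-filter-transpose f is xs) ⟩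
    length (filter P? (map (f i) xs)) + sum (map (λ j → length (filter P? (map (f j) xs))) is)
      ∎
    where open ≡-Reasoning

i≤j⇒j≡i+∣j-i∣ : {i j : ℤ} → i ℤ.≤ j → j ≡ i ℤ.+ ℤ.+ ∣ j ℤ.- i ∣
i≤j⇒j≡i+∣j-i∣ {i} {j} i≤j = begin
  j                        ≡⟨ ℤₚ.+-identityʳ j ⟨
  j ℤ.+ ℤ.0ℤ               ≡⟨ cong (ℤ._+_ j) (ℤₚ.+-inverseˡ i) ⟨
  j ℤ.+ (ℤ.- i ℤ.+ i)      ≡⟨ ℤₚ.+-assoc j (ℤ.- i) i ⟨
  (j ℤ.- i) ℤ.+ i          ≡⟨ ℤₚ.+-comm (j ℤ.- i) i ⟩
  i ℤ.+ (j ℤ.- i)          ≡⟨ cong (ℤ._+_ i) (ℤₚ.0≤i⇒+∣i∣≡i (ℤₚ.i≤j⇒0≤j-i i≤j)) ⟨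
  i ℤ.+ ℤ.+ ∣ j ℤ.- i ∣    ∎
  where open ≡-Reasoning

i+m<i+n⇒m<n : (i : ℤ) {m n : ℕ} → i ℤ.+ ℤ.+ m ℤ.< i ℤ.+ ℤ.+ n → m < n
i+m<i+n⇒m<n i i+m<i+n = ℕₚ.≰⇒> (λ n≤m → ℤₚ.<⇒≱ i+m<i+n (ℤₚ.+-monoʳ-≤ i (+≤+ n≤m)))

i<i+1 : (i : ℤ) → i ℤ.< i ℤ.+ ℤ.+ 1
i<i+1 i = ℤₚ.suc[i]≤j⇒i<j (ℤₚ.≤-reflexive (ℤₚ.+-comm (ℤ.+ 1) i))

-i<-[i-1] : (i : ℤ) → ℤ.- i ℤ.< ℤ.- (i ℤ.- ℤ.+ 1)
-i<-[i-1] i = ℤₚ.neg-mono-< (ℤₚ.i≤pred[j]⇒i<j (ℤₚ.≤-reflexive (ℤₚ.+-comm i ℤ.-1ℤ)))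

i+1≤suc[i] : (i : ℤ) → i ℤ.+ ℤ.+ 1 ℤ.≤ ℤ.suc i
i+1≤suc[i] i = ℤₚ.≤-reflexive (ℤₚ.+-comm i (ℤ.+ 1))

i-1≤suc[i] : (i : ℤ) → i ℤ.- ℤ.+ 1 ℤ.≤ ℤ.suc i
i-1≤suc[i] i = ℤₚ.≤-trans (ℤₚ.i-j≤i i (ℤ.+ 1)) (ℤₚ.i≤suc[i] i)

interval : ℤ → ℕ → List ℤ
interval lo = applyUpTo (λ i → lo ℤ.+ ℤ.+ i)

length-interval : (lo : ℤ) (k : ℕ) → length (interval lo k) ≡ k
length-interval lo = length-applyUpTo (λ i → lo ℤ.+ ℤ.+ i)

interval-unique : (lo : ℤ) (k : ℕ) → Unique (interval lo k)
interval-unique lo k = applyUpTo⁺₁ _ k (λ i<j _ eq → ℤₚ.<-irrefl eq (ℤₚ.+-monoʳ-< lo (+<+ i<j)))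

∈-interval⁺ : {lo x : ℤ} {k : ℕ} → lo ℤ.≤ x → x ℤ.< lo ℤ.+ ℤ.+ k → x ∈ interval lo k
∈-interval⁺ {lo} lo≤x x<lo+k with x≡ ← i≤j⇒j≡i+∣j-i∣ lo≤x =
  subst (_∈ interval lo _) (sym x≡) (∈-applyUpTo⁺ _ (i+m<i+n⇒m<n lo (subst (ℤ._< _) x≡ x<lo+k)))

∈-interval⁻ : {lo x : ℤ} {k : ℕ} → x ∈ interval lo k → lo ℤ.≤ x × x ℤ.< lo ℤ.+ ℤ.+ k
∈-interval⁻ {lo} x∈ with i , i<k , refl ← ∈-applyUpTo⁻ _ x∈ =
  ℤₚ.i≤i+j lo (ℤ.+ i) , ℤₚ.+-monoʳ-< lo (+<+ i<k)

record Side : Set where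
  field
    next        : Cell → Cell
    column      : Cell → ℤ
    height      : Cell → ℤ
    column-next : ∀ c → column (next c) ≡ column c
    height-next : ∀ c → height c ℤ.< height (next c)
open Side

right left up down : Side
right .next (x , y)  = x ℤ.+ ℤ.+ 1 , y
right .column        = proj₂
right .height        = proj₁
right .column-next _ = refl
right .height-next c = i<i+1 (proj₁ c)
left .next (x , y)   = x ℤ.- ℤ.+ 1 , y
left .column         = proj₂
left .height         = ℤ.-_ ∘ proj₁
left .column-next _  = refl
left .height-next c  = -i<-[i-1] (proj₁ c)
up .next (x , y)     = x , y ℤ.+ ℤ.+ 1
up .column           = proj₁
up .height           = proj₂
up .column-next _    = refl
up .height-next c    = i<i+1 (proj₂ c)
down .next (x , y)   = x , y ℤ.- ℤ.+ 1
down .column         = proj₁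
down .height         = ℤ.-_ ∘ proj₂
down .column-next _  = refl
down .height-next c  = -i<-[i-1] (proj₂ c)

sides : List Side
sides = right ∷ left ∷ up ∷ down ∷ []

outside? : (S : List Cell) → Decidable (_∉ S)
outside? S c = ¬? (c ∈? S)

-- One entry per boundary edge of S on side s.
border : Side → List Cell → List Cell
border s S = filter (outside? S) (map (next s) S)

-- `nbrs c` is definitionally `map (λ s → next s c) sides`.
perimeter≡sum-border : (P : Polyomino) → perimeter P ≡ sum (map (λ s → length (border s (cells P))) sides)
perimeter≡sum-border P = sum-length-filter-transpose (outside? (cells P)) next sides (cells P)

nbrs-coordinates : {c d : Cell} → d ∈ nbrs c →
  proj₁ d ℤ.≤ ℤ.suc (proj₁ c) × proj₂ d ℤ.≤ ℤ.suc (proj₂ c)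
nbrs-coordinates {x , y} (here refl)                         = i+1≤suc[i] x , ℤₚ.i≤suc[i] y
nbrs-coordinates {x , y} (there (here refl))                 = i-1≤suc[i] x , ℤₚ.i≤suc[i] y
nbrs-coordinates {x , y} (there (there (here refl)))         = ℤₚ.i≤suc[i] x , i+1≤suc[i] y
nbrs-coordinates {x , y} (there (there (there (here refl)))) = ℤₚ.i≤suc[i] x , i-1≤suc[i] y

module _ (π : Cell → ℤ) (π-nbrs : ∀ {c d} → d ∈ nbrs c → π d ℤ.≤ ℤ.suc (π c)) where

  walk-intermediate : {S : List Cell} {c d : Cell} {t : ℤ} →
    Walk S c d → π c ℤ.≤ t → t ℤ.≤ π d → t ∈ map π S
  walk-intermediate (stop c∈S) c≤t t≤c =
    subst (_∈ map π _) (ℤₚ.≤-antisym c≤t t≤c) (∈-map⁺ π c∈S)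
  walk-intermediate {t = t} (step {c} c∈S c′∈nbrs walk) c≤t t≤d with t ℤ.≤? π c
  ... | yes t≤c = subst (_∈ map π _) (ℤₚ.≤-antisym c≤t t≤c) (∈-map⁺ π c∈S)
  ... | no  t≰c = walk-intermediate walk (ℤₚ.≤-trans (π-nbrs c′∈nbrs) (ℤₚ.i<j⇒suc[i]≤j (ℤₚ.≰⇒> t≰c))) t≤d

  columns-interval : (P : Polyomino) {c : Cell} → c ∈ cells P →
    ∃₂ λ lo k → map π (cells P) ⊆ interval lo (suc k) × interval lo (suc k) ⊆ map π (cells P)
  columns-interval P {c} c∈P = π bottom , k , columns⊆interval , interval⊆columns
    where
    bottom top : Cell
    bottom = argmin π c (cells P)
    top    = argmax π c (cells P)
    bottom∈P : bottom ∈ cells P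
    bottom∈P = argmin-all π c∈P (All.tabulate id)
    top∈P : top ∈ cells P
    top∈P = argmax-all π c∈P (All.tabulate id)
    k : ℕ
    k = ∣ π top ℤ.- π bottom ∣
    top≡bottom+k : π top ≡ π bottom ℤ.+ ℤ.+ k
    top≡bottom+k = i≤j⇒j≡i+∣j-i∣
      (ℤₚ.≤-trans (f[argmin]≤f[⊤] {f = π} c (cells P)) (f[⊥]≤f[argmax] {f = π} c (cells P)))
    columns⊆interval : map π (cells P) ⊆ interval (π bottom) (suc k)
    columns⊆interval z∈ with d , d∈P , refl ← ∈-map⁻ π z∈ = ∈-interval⁺
      (All.lookup (f[argmin]≤f[xs] {f = π} c (cells P)) d∈P)
      (ℤₚ.≤-<-trans (All.lookup (f[xs]≤f[argmax] {f = π} c (cells P)) d∈P)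
        (subst (ℤ._< π bottom ℤ.+ ℤ.+ suc k) (sym top≡bottom+k)
          (ℤₚ.+-monoʳ-< (π bottom) (+<+ (ℕₚ.n<1+n k)))))
    interval⊆columns : interval (π bottom) (suc k) ⊆ map π (cells P)
    interval⊆columns t∈ with i , i<1+k , refl ← ∈-applyUpTo⁻ (λ i → π bottom ℤ.+ ℤ.+ i) t∈ =
      walk-intermediate (connected P bottom∈P top∈P)
        (ℤₚ.i≤i+j (π bottom) (ℤ.+ i))
        (subst (π bottom ℤ.+ ℤ.+ i ℤ.≤_) (sym top≡bottom+k)
          (ℤₚ.+-monoʳ-≤ (π bottom) (+≤+ (s≤s⁻¹ i<1+k))))

-- The highest cell of S in a column has its next cell outside S.
columns⊆border-columns : (s : Side) (S : List Cell) → map (column s) S ⊆ map (column s) (border s S)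
columns⊆border-columns s S z∈ with c , c∈S , refl ← ∈-map⁻ (column s) z∈ =
  subst (_∈ map (column s) (border s S)) next-highest-column
    (∈-map⁺ (column s) (∈-filter⁺ (outside? S) (∈-map⁺ (next s) highest∈S) next-highest∉S))
  where
  same-column : List Cell
  same-column = filter (λ d → column s d ℤ.≟ column s c) S
  highest : Cell
  highest = argmax (height s) c same-column
  highest-in-column : highest ∈ S × column s highest ≡ column s c
  highest-in-column = argmax-all (height s) (c∈S , refl) (All.tabulate (∈-filter⁻ _))
  highest∈S : highest ∈ S
  highest∈S = proj₁ highest-in-column
  next-highest-column : column s (next s highest) ≡ column s c
  next-highest-column = trans (column-next s highest) (proj₂ highest-in-column)
  next-highest∉S : next s highest ∉ S
  next-highest∉S next∈S = ℤₚ.<⇒≱ (height-next s highest)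
    (All.lookup (f[xs]≤f[argmax] {f = height s} c same-column) (∈-filter⁺ _ next∈S next-highest-column))

width≤border : (s : Side) {S : List Cell} (lo : ℤ) {k : ℕ} →
  interval lo k ⊆ map (column s) S → k ≤ length (border s S)
width≤border s {S} lo {k} interval⊆columns = begin
  k                                     ≡⟨ length-interval lo k ⟨
  length (interval lo k)                ≤⟨ length-mono-⊆ (interval-unique lo k)
                                             (columns⊆border-columns s S ∘ interval⊆columns) ⟩
  length (map (column s) (border s S))  ≡⟨ length-map (column s) (border s S) ⟩
  length (border s S)                   ∎
  where open ℕₚ.≤-Reasoning

area-bound : {x₀ y₀ : ℤ} {a b : ℕ} {S : List Cell} →
  Unique S → All (InRect x₀ y₀ a b) S → length S ≤ a * b
area-bound {x₀} {y₀} {a} {b} {S} S! S⊆rect = begin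
  length S
    ≤⟨ length-mono-⊆ S! S⊆box ⟩
  length (cartesianProduct (interval x₀ a) (interval y₀ b))
    ≡⟨ length-cartesianProduct (interval x₀ a) (interval y₀ b) ⟩
  length (interval x₀ a) * length (interval y₀ b)
    ≡⟨ cong₂ _*_ (length-interval x₀ a) (length-interval y₀ b) ⟩
  a * b
    ∎
  where
  open ℕₚ.≤-Reasoning
  S⊆box : S ⊆ cartesianProduct (interval x₀ a) (interval y₀ b)
  S⊆box c∈S with (x₀≤x , x<x₀+a) , (y₀≤y , y<y₀+b) ← All.lookup S⊆rect c∈S =
    ∈-cartesianProduct⁺ (∈-interval⁺ x₀≤x x<x₀+a) (∈-interval⁺ y₀≤y y<y₀+b)

InRect-widen : {x₀ y₀ : ℤ} {a a′ b : ℕ} {c : Cell} →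
  a ≤ a′ → InRect x₀ y₀ a b c → InRect x₀ y₀ a′ b c
InRect-widen {x₀} a≤a′ ((x₀≤x , x<x₀+a) , y-bounds) =
  (x₀≤x , ℤₚ.<-≤-trans x<x₀+a (ℤₚ.+-monoʳ-≤ x₀ (+≤+ a≤a′))) , y-bounds

bounding-box : (P : Polyomino) {c : Cell} → c ∈ cells P →
  ∃[ x₀ ] ∃[ y₀ ] ∃[ k ] ∃[ m ]
    (All (InRect x₀ y₀ (suc k) (suc m)) (cells P) × 2 * (suc k + suc m) ≤ perimeter P)
bounding-box P c∈P
  with x₀ , k , xs⊆ , ⊆xs ← columns-interval proj₁ (proj₁ ∘ nbrs-coordinates) P c∈P
     | y₀ , m , ys⊆ , ⊆ys ← columns-interval proj₂ (proj₂ ∘ nbrs-coordinates) P c∈P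
  = x₀ , y₀ , k , m , All.tabulate in-box , perimeter-bound
  where
  in-box : {d : Cell} → d ∈ cells P → InRect x₀ y₀ (suc k) (suc m) d
  in-box d∈P = ∈-interval⁻ (xs⊆ (∈-map⁺ proj₁ d∈P)) , ∈-interval⁻ (ys⊆ (∈-map⁺ proj₂ d∈P))
  perimeter-bound : 2 * (suc k + suc m) ≤ perimeter P
  perimeter-bound = begin
    2 * (suc k + suc m)
      ≡⟨ rearrange (suc k) (suc m) ⟩
    suc m + (suc m + (suc k + (suc k + 0)))
      ≤⟨ ℕₚ.+-mono-≤ (width≤border right y₀ ⊆ys) (ℕₚ.+-mono-≤ (width≤border left y₀ ⊆ys)
           (ℕₚ.+-mono-≤ (width≤border up x₀ ⊆xs) (ℕₚ.+-mono-≤ (width≤border down x₀ ⊆xs) ℕₚ.≤-refl))) ⟩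
    sum (map (λ s → length (border s (cells P))) sides)
      ≡⟨ perimeter≡sum-border P ⟨
    perimeter P
      ∎
    where
    open ℕₚ.≤-Reasoning
    rearrange : ∀ K M → 2 * (K + M) ≡ M + (M + (K + (K + 0)))
    rearrange = solve-∀

lemma6 : (P : Polyomino) →
    perimeter P ≡ minPerimeter (size P) →
    (∃[ c ] (c ∈ cells P × degree P c ≡ 1)) →
    ∃[ a ] ∃[ b ] ∃[ x₀ ] ∃[ y₀ ]
      (1 ≤ a × 1 ≤ b × 2 * (a + b) ≡ minPerimeter (size P) × a * b ≥ size P
        × All (InRect x₀ y₀ a b) (cells P))
-- The degree-1 cell is only used as a witness that P is nonempty.
lemma6 P perimeter≡p (c , c∈P , _)
  with x₀ , y₀ , k , m , P⊆box , 2[K+M]≤perimeter ← bounding-box P c∈P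
  = a , M , x₀ , y₀ , ℕₚ.≤-trans (s≤s z≤n) K≤a , s≤s z≤n , cong (2 *_) a+M≡s
  , ℕₚ.≤-trans (area-bound (unique P) P⊆box) (ℕₚ.*-monoˡ-≤ M K≤a)
  , All.map (InRect-widen K≤a) P⊆box
  where
  K M s a : ℕ
  K = suc k
  M = suc m
  s = ceilSqrt (4 * size P)
  a = s ∸ M
  K+M≤s : K + M ≤ s
  K+M≤s = ℕₚ.*-cancelˡ-≤ 2 (ℕₚ.≤-trans 2[K+M]≤perimeter (ℕₚ.≤-reflexive perimeter≡p))
  K≤a : K ≤ a
  K≤a = ℕₚ.m+n≤o⇒m≤o∸n K K+M≤s
  a+M≡s : a + M ≡ s
  a+M≡s = ℕₚ.m∸n+n≡m (ℕₚ.m+n≤o⇒n≤o K K+M≤s)
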